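{- Let $\Sigma$ be a partition. For all $\mathcal{B},\mathcal{B}'\subseteq\mathrm{Pow}_{1,2}(\Sigma)$, we have $\bigcup\mathrm{Pow}^*_{1,2}[\mathcal{B}]=\bigcup\mathrm{Pow}^*_{1,2}[\mathcal{B}']$ if and only if $\mathcal{B}=\mathcal{B}'$.
   Context: A partition is a set of pairwise disjoint nonempty sets. For a set $S$, $\mathrm{Pow}_{1,2}(S):=\{t\subseteq S: 1\le|t|\le 2\}$ and $\mathrm{Pow}^*_{1,2}(S):=\{t\subseteq\bigcup S : 1\le|t|\le 2 \text{ and } t\cap s\ne\emptyset \text{ for every } s\in S\}$. For a collection $\mathcal{B}$ of sets, $\mathrm{Pow}^*_{1,2}[\mathcal{B}]:=\{\mathrm{Pow}^*_{1,2}(X): X\in\mathcal{B}\}$. -}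

module Defs where

open import Level using (0ℓ)
open import Relation.Unary using (Pred; _∈_; _⊆_; _≐_)
open import Data.Product using (Σ; ∃; ∃₂; _×_)
open import Data.Sum using (_⊎_)
open import Relation.Binary.PropositionalEquality using (_≡_)

-- The partition Σ is presented as an indexed family  block : I → Pred U 0ℓ
-- of subsets of a ground type U (the members of Σ are the blocks).
-- Nonempty blocks, pairwise disjoint (stated positively: a common element
-- forces the same index; this also makes i ↦ block i injective, so the
-- index type I is in bijection with Σ).
record IsPartition {U I : Set} (block : I → Pred U 0ℓ) : Set where
  field
    nonempty : ∀ i → ∃ λ a → a ∈ block i
    disjoint : ∀ i j a → a ∈ block i → a ∈ block j → i ≡ j

-- the set {x, y}  (x = y allowed, so this is a 1- or 2-element set)
⟦_,_⟧ : {A : Set} → A → A → Pred A 0ℓ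
⟦ x , y ⟧ = λ z → z ≡ x ⊎ z ≡ y

Card12 : {A : Set} → Pred A 0ℓ → Set
Card12 t = ∃₂ λ x y → t ≐ ⟦ x , y ⟧

Pow12 : {A : Set} → Pred A 0ℓ → Pred (Pred A 0ℓ) 0ℓ
Pow12 S t = t ⊆ S × Card12 t

⋃blocks : {U I : Set} → (I → Pred U 0ℓ) → Pred I 0ℓ → Pred U 0ℓ
⋃blocks block X a = ∃ λ i → i ∈ X × a ∈ block i

Pow12* : {U I : Set} → (I → Pred U 0ℓ) → Pred I 0ℓ → Pred (Pred U 0ℓ) 0ℓ
Pow12* block X t =
  t ⊆ ⋃blocks block X × Card12 t × (∀ i → i ∈ X → ∃ λ a → a ∈ t × a ∈ block i)

⋃Pow12* : {U I : Set} → (I → Pred U 0ℓ) → Pred (Pred I 0ℓ) 0ℓ → Pred (Pred U 0ℓ) (Level.suc 0ℓ)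
⋃Pow12* block 𝓑 t = ∃ λ X → X ∈ 𝓑 × Pow12* block X t

-- a "set of sets" must respect extensional equality of its members
Extensional : {A : Set} → Pred (Pred A 0ℓ) 0ℓ → Set₁
Extensional 𝓑 = ∀ {X Y} → X ≐ Y → X ∈ 𝓑 → Y ∈ 𝓑

-- A member t of Pow*_{1,2}(X) is a transversal of X: it lies in ⋃X and meets
-- every block of X.  As the blocks are disjoint, such a t recovers X as the
-- set of blocks it meets, so the sets Pow*_{1,2}(X) are pairwise disjoint;
-- and each is nonempty, since a point from each of the (at most two) blocks
-- of X forms a transversal.  Hence ⋃Pow*_{1,2}[𝓑] determines 𝓑.
{-# OPTIONS --safe #-}
module Submission where

open import Defs
open import Level using (0ℓ)
open import Relation.Unary using (Pred; _∈_; _⊆_; _≐_; U)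
open import Function.Base using (id)
open import Function.Bundles using (_⇔_; mk⇔)
open import Data.Product using (∃; _×_; _,_; proj₂)
open import Data.Sum using (inj₁; inj₂)
open import Relation.Binary.PropositionalEquality using (refl; subst)

⋃Pow12*-mono : {E I : Set} (block : I → Pred E 0ℓ) {𝓑 𝓑′ : Pred (Pred I 0ℓ) 0ℓ} →
  𝓑 ⊆ 𝓑′ → ⋃Pow12* block 𝓑 ⊆ ⋃Pow12* block 𝓑′
⋃Pow12*-mono block 𝓑⊆𝓑′ (X , X∈𝓑 , t∈) = X , 𝓑⊆𝓑′ X∈𝓑 , t∈

module _ {E I : Set} {block : I → Pred E 0ℓ} (partition : IsPartition block) where
  open IsPartition partition

  meetsAll⇒⊆ : {X Y : Pred I 0ℓ} {t : Pred E 0ℓ} → t ⊆ ⋃blocks block X →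
    (∀ k → k ∈ Y → ∃ λ c → c ∈ t × c ∈ block k) → Y ⊆ X
  meetsAll⇒⊆ {X} t⊆⋃X meets {k} k∈Y with meets k k∈Y
  ... | c , c∈t , c∈k with t⊆⋃X c∈t
  ...   | m , m∈X , c∈m = subst X (disjoint m k c c∈m c∈k) m∈X

  Pow12*-disjoint : {X Y : Pred I 0ℓ} {t : Pred E 0ℓ} →
    t ∈ Pow12* block X → t ∈ Pow12* block Y → X ≐ Y
  Pow12*-disjoint (t⊆⋃X , _ , meetsX) (t⊆⋃Y , _ , meetsY) =
    meetsAll⇒⊆ t⊆⋃Y meetsX , meetsAll⇒⊆ t⊆⋃X meetsY

  Pow12*-nonempty : {X : Pred I 0ℓ} → Card12 X → ∃ λ t → t ∈ Pow12* block X
  Pow12*-nonempty {X} (i , j , X⊆ij , ij⊆X) with nonempty i | nonempty j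
  ... | a , a∈i | b , b∈j = ⟦ a , b ⟧ , ab⊆⋃X , (a , b , id , id) , meetsX
    where
    ab⊆⋃X : ⟦ a , b ⟧ ⊆ ⋃blocks block X
    ab⊆⋃X (inj₁ refl) = i , ij⊆X (inj₁ refl) , a∈i
    ab⊆⋃X (inj₂ refl) = j , ij⊆X (inj₂ refl) , b∈j

    meetsX : ∀ k → k ∈ X → ∃ λ c → c ∈ ⟦ a , b ⟧ × c ∈ block k
    meetsX k k∈X with X⊆ij k∈X
    ... | inj₁ refl = a , inj₁ refl , a∈i
    ... | inj₂ refl = b , inj₂ refl , b∈j

  ⋃Pow12*-reflects-⊆ : {𝓑 𝓑′ : Pred (Pred I 0ℓ) 0ℓ} → Extensional 𝓑′ → 𝓑 ⊆ Pow12 U →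
    ⋃Pow12* block 𝓑 ⊆ ⋃Pow12* block 𝓑′ → 𝓑 ⊆ 𝓑′
  ⋃Pow12*-reflects-⊆ ext′ 𝓑⊆Pow12 sub {X} X∈𝓑
    with Pow12*-nonempty (proj₂ (𝓑⊆Pow12 X∈𝓑))
  ... | t , t∈X with sub (X , X∈𝓑 , t∈X)
  ...   | Y , Y∈𝓑′ , t∈Y = ext′ (Pow12*-disjoint t∈Y t∈X) Y∈𝓑′

lemma9 : {E I : Set} (block : I → Pred E 0ℓ) → IsPartition block →
    (𝓑 𝓑′ : Pred (Pred I 0ℓ) 0ℓ) → Extensional 𝓑 → Extensional 𝓑′ →
    𝓑 ⊆ Pow12 U → 𝓑′ ⊆ Pow12 U →
    ((⋃Pow12* block 𝓑 ≐ ⋃Pow12* block 𝓑′) ⇔ (𝓑 ≐ 𝓑′))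
lemma9 block partition 𝓑 𝓑′ ext ext′ 𝓑⊆Pow12 𝓑′⊆Pow12 = mk⇔
  (λ (⊆′ , ⊇′) → ⋃Pow12*-reflects-⊆ partition ext′ 𝓑⊆Pow12 ⊆′
               , ⋃Pow12*-reflects-⊆ partition ext 𝓑′⊆Pow12 ⊇′)
  (λ (⊆′ , ⊇′) → ⋃Pow12*-mono block ⊆′ , ⋃Pow12*-mono block ⊇′)
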